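{- Let $G_1$ and $G_2$ be connected graphs with exactly one common vertex $x$, let $G=G_1\cup G_2$, and suppose $x\in V^{012}(G_1)$ and $x\in V^{01}(G_2)$. Then $\gamma_R(G)=\gamma_R(G_1)+\gamma_R(G_2)-1$ and $x\in V^{012}(G)$.
   Context: All graphs are finite and simple. A Roman dominating function (RDF) on a graph $G$ is a map $f:V(G)\to\{0,1,2\}$ such that every vertex $v$ with $f(v)=0$ has a neighbor $u$ with $f(u)=2$; its weight is $\sum_v f(v)$. $\gamma_R(G)$ is the minimum weight of an RDF on $G$; an RDF of that weight is a $\gamma_R$-function. For $X\subseteq\{0,1,2\}$, $V^X(G)$ is the set of vertices $v$ with $\{f(v): f\text{ a }\gamma_R\text{ -function on }G\}=X$; $V^{01}=V^{\{0,1\}}$, $V^{012}=V^{\{0,1,2\}}$. -}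

module Defs where

open import Data.Nat using (ℕ; _≤_)
open import Data.Fin using (Fin; zero; suc; toℕ)
open import Data.Bool using (Bool; true)
open import Data.List using (map; allFin)
open import Data.Nat.ListAction using (sum)
open import Data.Product using (Σ; ∃; ∃-syntax; _×_; _,_)
open import Data.Sum using (_⊎_)
open import Relation.Binary.PropositionalEquality using (_≡_; _≢_)
open import Relation.Nullary using (¬_)

record Graph (n : ℕ) : Set where
  field
    adj   : Fin n → Fin n → Bool
    sym   : ∀ u v → adj u v ≡ adj v u
    irrefl : ∀ v → ¬ (adj v v ≡ true)

open Graph public

Adj : {n : ℕ} → Graph n → Fin n → Fin n → Set
Adj G u v = adj G u v ≡ true

data Reach {n : ℕ} (G : Graph n) : Fin n → Fin n → Set where
  here : ∀ {v} → Reach G v v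
  step : ∀ {u w v} → Adj G u w → Reach G w v → Reach G u v

Connected : {n : ℕ} → Graph n → Set
Connected {n} G = Fin n × (∀ u v → Reach G u v)

two : Fin 3
two = suc (suc zero)

one : Fin 3
one = suc zero

IsRDF : {n : ℕ} → Graph n → (Fin n → Fin 3) → Set
IsRDF {n} G f = ∀ v → f v ≡ zero → ∃[ u ] (Adj G v u × f u ≡ two)

weight : {n : ℕ} → (Fin n → Fin 3) → ℕ
weight {n} f = sum (map (λ v → toℕ (f v)) (allFin n))

IsγRFun : {n : ℕ} → Graph n → (Fin n → Fin 3) → Set
IsγRFun {n} G f = IsRDF G f × (∀ g → IsRDF G g → weight f ≤ weight g)

IsγR : {n : ℕ} → Graph n → ℕ → Set
IsγR {n} G w =
  (∃[ f ] (IsRDF G f × weight f ≡ w)) × (∀ g → IsRDF G g → w ≤ weight g)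

InV012 : {n : ℕ} → Graph n → Fin n → Set
InV012 {n} G x = ∀ (k : Fin 3) → ∃[ f ] (IsγRFun G f × f x ≡ k)

InV01 : {n : ℕ} → Graph n → Fin n → Set
InV01 {n} G x =
  (∃[ f ] (IsγRFun G f × f x ≡ zero)) ×
  (∃[ f ] (IsγRFun G f × f x ≡ one)) ×
  (∀ f → IsγRFun G f → f x ≢ two)

-- G is the union G₁ ∪ G₂ (up to the vertex embeddings ι₁, ι₂), where G₁ and
-- G₂ share exactly one vertex x, which is x₁ in G₁ and x₂ in G₂.
record IsUnionAt {n₁ n₂ n : ℕ} (G₁ : Graph n₁) (G₂ : Graph n₂) (G : Graph n)
                 (x₁ : Fin n₁) (x₂ : Fin n₂) : Set where
  field
    ι₁ : Fin n₁ → Fin n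
    ι₂ : Fin n₂ → Fin n
    ι₁-inj : ∀ a b → ι₁ a ≡ ι₁ b → a ≡ b
    ι₂-inj : ∀ a b → ι₂ a ≡ ι₂ b → a ≡ b
    cover  : ∀ v → (∃[ a ] (ι₁ a ≡ v)) ⊎ (∃[ b ] (ι₂ b ≡ v))
    common : ι₁ x₁ ≡ ι₂ x₂
    only   : ∀ a b → ι₁ a ≡ ι₂ b → (a ≡ x₁ × b ≡ x₂)
    edges→ : ∀ u v → Adj G u v →
               (∃[ a ] ∃[ b ] (ι₁ a ≡ u × ι₁ b ≡ v × Adj G₁ a b)) ⊎
               (∃[ a ] ∃[ b ] (ι₂ a ≡ u × ι₂ b ≡ v × Adj G₂ a b))
    edges₁ : ∀ a b → Adj G₁ a b → Adj G (ι₁ a) (ι₁ b)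
    edges₂ : ∀ a b → Adj G₂ a b → Adj G (ι₂ a) (ι₂ b)

open IsUnionAt public

module Submission where

-- Glueing a γ_R-function f₁ of G₁ with f₁(x) = k to a γ_R-function f₂ of G₂ with f₂(x) = 1 gives
-- an RDF of G of weight γ_R(G₁) + γ_R(G₂) − 1 with value k at x: no vertex of G₂ relies on x
-- for domination, because f₂(x) ≠ 2.  Conversely, an RDF g of G restricts to RDFs h₁, h₂ of G₁
-- and G₂ (when g(x) = 0, relabel x by 1 on the side not containing its 2-neighbour), and the
-- cases g(x) = 2, 1, 0 give w(h₁) + w(h₂) = w(g) + 2, w(g) + 1, w(g) + 1; in the first case
-- h₂(x) = 2, so x ∈ V^{01}(G₂) forces w(h₂) > γ_R(G₂).  Either way γ_R(G₁) + γ_R(G₂) ≤ w(g) + 1.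

open import Defs hiding (sym)
open import Data.Nat using (ℕ; _+_; _∸_; _≤_; _<_; _≤?_; s≤s⁻¹)
open import Data.Nat.Properties
  using (+-assoc; +-comm; +-suc; +-cancelʳ-≡; +-mono-≤; ≤-trans; ≤-antisym; ≰⇒>;
         m+n∸n≡m; m≤n+o⇒m∸n≤o)
open import Data.Nat.Tactic.RingSolver using (solve-∀)
open import Data.Nat.ListAction using (sum)
open import Data.Nat.ListAction.Properties using (sum-++; sum-↭)
open import Data.Fin using (Fin; zero; suc; toℕ)
open import Data.Fin.Properties using (_≟_)
open import Data.List using (List; _∷_; _++_; map; allFin; filter)
open import Data.List.Properties using (map-++; map-∘; map-cong; map-cong-local)
open import Data.List.Membership.Propositional using (_∈_)
open import Data.List.Membership.Propositional.Properties
  using (∈-map⁺; ∈-map⁻; ∈-++⁺ˡ; ∈-++⁺ʳ; ∈-filter⁺; ∈-filter⁻; ∈-allFin)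
open import Data.List.Membership.Propositional.Properties.WithK using (unique∧set⇒bag)
open import Data.List.Relation.Binary.BagAndSetEquality using (∼bag⇒↭)
open import Data.List.Relation.Binary.Permutation.Propositional using (_↭_)
open import Data.List.Relation.Binary.Permutation.Propositional.Properties using (map⁺)
open import Data.List.Relation.Unary.All using (tabulate)
open import Data.List.Relation.Unary.AllPairs using (_∷_)
open import Data.List.Relation.Unary.Any using (here; there)
open import Data.List.Relation.Unary.Unique.Propositional using (Unique)
import Data.List.Relation.Unary.Unique.Propositional.Properties as Unique
open import Data.Vec.Functional using (Vector; updateAt)
open import Data.Vec.Functional.Properties using (updateAt-updates; updateAt-minimal)
open import Data.Product using (∃-syntax; _×_; _,_; proj₁; proj₂)
open import Data.Sum using (_⊎_; inj₁; inj₂; [_,_]′) renaming (swap to ⊎-swap)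
open import Function using (_∘_; const)
open import Function.Bundles using (mk⇔)
open import Relation.Binary.PropositionalEquality
  using (_≡_; _≢_; refl; sym; trans; cong; cong₂; subst; subst₂; module ≡-Reasoning)
open import Relation.Nullary using (¬_; yes; no; ¬?; contradiction)

cancel-+ : ∀ {a w} s t → a + t ≡ w + (s + t) → a ≡ w + s
cancel-+ {a} {w} s t eq = +-cancelʳ-≡ t a (w + s) (trans eq (sym (+-assoc w s t)))

unique-same-members⇒↭ : {A : Set} {xs ys : List A} → Unique xs → Unique ys →
  (∀ {z} → z ∈ xs → z ∈ ys) → (∀ {z} → z ∈ ys → z ∈ xs) → xs ↭ ys
unique-same-members⇒↭ uxs uys to from = ∼bag⇒↭ (unique∧set⇒bag uxs uys (mk⇔ to from))

sum-map-↭ : {A : Set} (k : A → ℕ) {xs ys : List A} → xs ↭ ys → sum (map k xs) ≡ sum (map k ys)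
sum-map-↭ k xs↭ys = sum-↭ (map⁺ k xs↭ys)

sumFin : {m : ℕ} → (Fin m → ℕ) → ℕ
sumFin {m} k = sum (map k (allFin m))

sumFin-cong : ∀ {m} {k k′ : Fin m → ℕ} → (∀ v → k v ≡ k′ v) → sumFin k ≡ sumFin k′
sumFin-cong {m} k≗k′ = cong sum (map-cong k≗k′ (allFin m))

allFin-except : {m : ℕ} → Fin m → List (Fin m)
allFin-except {m} x = filter (λ v → ¬? (v ≟ x)) (allFin m)

∈-allFin-except⁺ : ∀ {m} {x v : Fin m} → v ≢ x → v ∈ allFin-except x
∈-allFin-except⁺ {x = x} {v} v≢x = ∈-filter⁺ (λ u → ¬? (u ≟ x)) (∈-allFin v) v≢x

∈-allFin-except⁻ : ∀ {m} {x v : Fin m} → v ∈ allFin-except x → v ≢ x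
∈-allFin-except⁻ {m} {x} v∈ = proj₂ (∈-filter⁻ (λ u → ¬? (u ≟ x)) {xs = allFin m} v∈)

allFin-except-unique : ∀ {m} (x : Fin m) → Unique (allFin-except x)
allFin-except-unique {m} x = Unique.filter⁺ (λ v → ¬? (v ≟ x)) (Unique.allFin⁺ m)

sumFin-split : ∀ {m} (x : Fin m) (k : Fin m → ℕ) →
  sumFin k ≡ k x + sum (map k (allFin-except x))
sumFin-split {m} x k =
  sum-map-↭ k (unique-same-members⇒↭ (Unique.allFin⁺ m) unique (λ {z} _ → split z) (λ {z} _ → ∈-allFin z))
  where
  unique : Unique (x ∷ allFin-except x)
  unique = tabulate (λ z∈ x≡z → ∈-allFin-except⁻ z∈ (sym x≡z)) ∷ allFin-except-unique x
  split : ∀ z → z ∈ x ∷ allFin-except x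
  split z with z ≟ x
  ... | yes z≡x = here z≡x
  ... | no z≢x = there (∈-allFin-except⁺ z≢x)

sumFin-update : ∀ {m} (x : Fin m) {k k′ : Fin m → ℕ} → (∀ v → v ≢ x → k v ≡ k′ v) →
  sumFin k + k′ x ≡ sumFin k′ + k x
sumFin-update x {k} {k′} agree = begin
  sumFin k + k′ x                             ≡⟨ cong (_+ k′ x) (sumFin-split x k) ⟩
  k x + sum (map k (allFin-except x)) + k′ x  ≡⟨ cong (λ s → k x + s + k′ x) rest ⟩
  k x + R + k′ x                              ≡⟨ rearrange (k x) R (k′ x) ⟩
  k′ x + R + k x                              ≡⟨ cong (_+ k x) (sym (sumFin-split x k′)) ⟩
  sumFin k′ + k x                             ∎
  where
  open ≡-Reasoning
  R = sum (map k′ (allFin-except x))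
  rest : sum (map k (allFin-except x)) ≡ R
  rest = cong sum (map-cong-local (tabulate (λ v∈ → agree _ (∈-allFin-except⁻ v∈))))
  rearrange : ∀ a r b → a + r + b ≡ b + r + a
  rearrange = solve-∀

weight-cong : ∀ {m} {f f′ : Fin m → Fin 3} → (∀ v → f v ≡ f′ v) → weight f ≡ weight f′
weight-cong f≗f′ = sumFin-cong (cong toℕ ∘ f≗f′)

_[_]≔_ : {A : Set} {m : ℕ} → Vector A m → Fin m → A → Vector A m
f [ x ]≔ c = updateAt f x (const c)

[]≔-preserves : {A : Set} {m : ℕ} (P : A → Set) (f : Vector A m) (x : Fin m) (c : A) →
  (P (f x) → P c) → ∀ v → P (f v) → P ((f [ x ]≔ c) v)
[]≔-preserves P f x c keep v Pfv with v ≟ x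
... | yes refl = subst P (sym (updateAt-updates x f)) (keep Pfv)
... | no v≢x = subst P (sym (updateAt-minimal v x f v≢x)) Pfv

weight-update : ∀ {m} (f : Fin m → Fin 3) (x : Fin m) (c : Fin 3) →
  weight (f [ x ]≔ c) + toℕ (f x) ≡ weight f + toℕ c
weight-update f x c =
  trans (sumFin-update x (λ v v≢x → cong toℕ (updateAt-minimal v x f v≢x)))
        (cong (λ d → weight f + toℕ d) (updateAt-updates x f))

γR-function-weight : ∀ {m} {H : Graph m} {f w} → IsγRFun H f → IsγR H w → weight f ≡ w
γR-function-weight (f-rdf , f-min) ((f₀ , f₀-rdf , f₀≡w) , w-min) =
  ≤-antisym (subst (_ ≤_) f₀≡w (f-min f₀ f₀-rdf)) (w-min _ f-rdf)

γR-function-of-weight : ∀ {m} {H : Graph m} {h w} → IsRDF H h → weight h ≡ w →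
  (∀ g → IsRDF H g → w ≤ weight g) → IsγRFun H h
γR-function-of-weight h-rdf h≡w w-min = h-rdf , λ g g-rdf → subst (_≤ weight g) (sym h≡w) (w-min g g-rdf)

excluded-value⇒γR<weight : ∀ {m} {H : Graph m} {w x k h} → IsγR H w →
  (∀ f → IsγRFun H f → f x ≢ k) → IsRDF H h → h x ≡ k → w < weight h
excluded-value⇒γR<weight {w = w} {h = h} (_ , w-min) excluded h-rdf hx≡k with weight h ≤? w
... | yes h≤w = contradiction hx≡k (excluded h (h-rdf , λ g g-rdf → ≤-trans h≤w (w-min g g-rdf)))
... | no h≰w = ≰⇒> h≰w

IsUnionAt-swap : ∀ {n₁ n₂ n} {G₁ : Graph n₁} {G₂ : Graph n₂} {G : Graph n} {x₁ x₂} →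
  IsUnionAt G₁ G₂ G x₁ x₂ → IsUnionAt G₂ G₁ G x₂ x₁
IsUnionAt-swap U = record
  { ι₁ = ι₂ U ; ι₂ = ι₁ U ; ι₁-inj = ι₂-inj U ; ι₂-inj = ι₁-inj U
  ; cover = λ v → ⊎-swap (cover U v)
  ; common = sym (common U)
  ; only = λ b a ι₂b≡ι₁a → let (a≡x₁ , b≡x₂) = only U a b (sym ι₂b≡ι₁a) in b≡x₂ , a≡x₁
  ; edges→ = λ u v adj → ⊎-swap (edges→ U u v adj)
  ; edges₁ = edges₂ U ; edges₂ = edges₁ U
  }

module Union {n₁ n₂ n : ℕ} {G₁ : Graph n₁} {G₂ : Graph n₂} {G : Graph n}
             {x₁ : Fin n₁} {x₂ : Fin n₂} (U : IsUnionAt G₁ G₂ G x₁ x₂) where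

  ι₁-neighbour : ∀ a u → Adj G (ι₁ U a) u →
    (∃[ b ] (ι₁ U b ≡ u × Adj G₁ a b)) ⊎ (a ≡ x₁ × ∃[ b ] (ι₂ U b ≡ u × Adj G₂ x₂ b))
  ι₁-neighbour a u adj with edges→ U (ι₁ U a) u adj
  ... | inj₁ (a′ , b , ι₁a′≡ι₁a , ι₁b≡u , adj₁) with ι₁-inj U a′ a ι₁a′≡ι₁a
  ...   | refl = inj₁ (b , ι₁b≡u , adj₁)
  ι₁-neighbour a u adj | inj₂ (a′ , b , ι₂a′≡ι₁a , ι₂b≡u , adj₂) with only U a a′ (sym ι₂a′≡ι₁a)
  ...   | refl , refl = inj₂ (refl , b , ι₂b≡u , adj₂)

  union-list : List (Fin n)
  union-list = map (ι₁ U) (allFin n₁) ++ map (ι₂ U) (allFin-except x₂)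

  union-list-unique : Unique union-list
  union-list-unique =
    Unique.++⁺ (Unique.map⁺ (λ {a} {b} → ι₁-inj U a b) (Unique.allFin⁺ n₁))
               (Unique.map⁺ (λ {a} {b} → ι₂-inj U a b) (allFin-except-unique x₂))
               disjoint
    where
    disjoint : ∀ {v} → ¬ (v ∈ map (ι₁ U) (allFin n₁) × v ∈ map (ι₂ U) (allFin-except x₂))
    disjoint (v∈₁ , v∈₂) with ∈-map⁻ (ι₁ U) v∈₁ | ∈-map⁻ (ι₂ U) v∈₂
    ... | a , _ , v≡ι₁a | b , b∈ , v≡ι₂b =
      ∈-allFin-except⁻ b∈ (proj₂ (only U a b (trans (sym v≡ι₁a) v≡ι₂b)))

  ∈-union-list : ∀ v → v ∈ union-list
  ∈-union-list v with cover U v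
  ... | inj₁ (a , refl) = ∈-++⁺ˡ (∈-map⁺ (ι₁ U) (∈-allFin a))
  ... | inj₂ (b , refl) with b ≟ x₂
  ...   | yes refl = ∈-++⁺ˡ (subst (_∈ map (ι₁ U) (allFin n₁)) (common U) (∈-map⁺ (ι₁ U) (∈-allFin x₁)))
  ...   | no b≢x₂ = ∈-++⁺ʳ (map (ι₁ U) (allFin n₁)) (∈-map⁺ (ι₂ U) (∈-allFin-except⁺ b≢x₂))

  sumFin-union : (k : Fin n → ℕ) →
    sumFin k + k (ι₁ U x₁) ≡ sumFin (k ∘ ι₁ U) + sumFin (k ∘ ι₂ U)
  sumFin-union k = begin
    sumFin k + k (ι₁ U x₁)
      ≡⟨ cong (_+ k (ι₁ U x₁)) (sum-map-↭ k all↭union-list) ⟩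
    sum (map k union-list) + k (ι₁ U x₁)
      ≡⟨ cong (_+ k (ι₁ U x₁)) sum-union-list ⟩
    S₁ + S₂ + k (ι₁ U x₁)
      ≡⟨ rearrange S₁ S₂ (k (ι₁ U x₁)) ⟩
    S₁ + (k (ι₁ U x₁) + S₂)
      ≡⟨ cong (λ v → S₁ + (k v + S₂)) (common U) ⟩
    S₁ + (k (ι₂ U x₂) + S₂)
      ≡⟨ cong (S₁ +_) (sym (sumFin-split x₂ (k ∘ ι₂ U))) ⟩
    sumFin (k ∘ ι₁ U) + sumFin (k ∘ ι₂ U)
      ∎
    where
    open ≡-Reasoning
    S₁ = sumFin (k ∘ ι₁ U)
    S₂ = sum (map (k ∘ ι₂ U) (allFin-except x₂))
    all↭union-list : allFin n ↭ union-list
    all↭union-list = unique-same-members⇒↭ (Unique.allFin⁺ n) union-list-unique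
                       (λ {v} _ → ∈-union-list v) (λ {v} _ → ∈-allFin v)
    sum-union-list : sum (map k union-list) ≡ S₁ + S₂
    sum-union-list = begin
      sum (map k union-list)
        ≡⟨ cong sum (map-++ k (map (ι₁ U) (allFin n₁)) (map (ι₂ U) (allFin-except x₂))) ⟩
      sum (map k (map (ι₁ U) (allFin n₁)) ++ map k (map (ι₂ U) (allFin-except x₂)))
        ≡⟨ sum-++ (map k (map (ι₁ U) (allFin n₁))) _ ⟩
      sum (map k (map (ι₁ U) (allFin n₁))) + sum (map k (map (ι₂ U) (allFin-except x₂)))
        ≡⟨ cong₂ (λ s t → sum s + sum t) (sym (map-∘ (allFin n₁))) (sym (map-∘ (allFin-except x₂))) ⟩
      S₁ + S₂
        ∎
    rearrange : ∀ a b c → a + b + c ≡ a + (c + b)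
    rearrange = solve-∀

  weight-union : (g : Fin n → Fin 3) →
    weight g + toℕ (g (ι₁ U x₁)) ≡ weight (g ∘ ι₁ U) + weight (g ∘ ι₂ U)
  weight-union g = sumFin-union (toℕ ∘ g)

  restrict-RDF : ∀ {g} → IsRDF G g → (c : Fin 3) →
    (g (ι₁ U x₁) ≡ two → c ≡ two) →
    (c ≡ zero → ∃[ b ] (Adj G₁ x₁ b × g (ι₁ U b) ≡ two)) →
    IsRDF G₁ ((g ∘ ι₁ U) [ x₁ ]≔ c)
  restrict-RDF {g} g-rdf c keep-two dominated a ha≡0 with a ≟ x₁
  ... | yes refl =
    let (b , adj , gb≡2) = dominated (trans (sym (updateAt-updates x₁ (g ∘ ι₁ U))) ha≡0)
        b≢x₁ : b ≢ x₁
        b≢x₁ b≡x₁ = irrefl G₁ x₁ (subst (Adj G₁ x₁) b≡x₁ adj)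
    in b , adj , trans (updateAt-minimal b x₁ (g ∘ ι₁ U) b≢x₁) gb≡2
  ... | no a≢x₁ with g-rdf (ι₁ U a) (trans (sym (updateAt-minimal a x₁ (g ∘ ι₁ U) a≢x₁)) ha≡0)
  ...   | u , adj , gu≡2 with ι₁-neighbour a u adj
  ...     | inj₁ (b , refl , adj₁) = b , adj₁ , []≔-preserves (_≡ two) (g ∘ ι₁ U) x₁ c keep-two b gu≡2
  ...     | inj₂ (a≡x₁ , _) = contradiction a≡x₁ a≢x₁

  -- Overwriting f₂ at x makes the value at x independent of the side chosen by `cover`.
  glue : (Fin n₁ → Fin 3) → (Fin n₂ → Fin 3) → Fin n → Fin 3
  glue f₁ f₂ v = [ f₁ ∘ proj₁ , (f₂ [ x₂ ]≔ f₁ x₁) ∘ proj₁ ]′ (cover U v)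

  glue-ι₁ : ∀ f₁ f₂ a → glue f₁ f₂ (ι₁ U a) ≡ f₁ a
  glue-ι₁ f₁ f₂ a with cover U (ι₁ U a)
  ... | inj₁ (a′ , ι₁a′≡ι₁a) = cong f₁ (ι₁-inj U a′ a ι₁a′≡ι₁a)
  ... | inj₂ (b , ι₂b≡ι₁a) with only U a b (sym ι₂b≡ι₁a)
  ...   | refl , refl = updateAt-updates x₂ f₂

  glue-ι₂ : ∀ f₁ f₂ b → glue f₁ f₂ (ι₂ U b) ≡ (f₂ [ x₂ ]≔ f₁ x₁) b
  glue-ι₂ f₁ f₂ b with cover U (ι₂ U b)
  ... | inj₂ (b′ , ι₂b′≡ι₂b) = cong (f₂ [ x₂ ]≔ f₁ x₁) (ι₂-inj U b′ b ι₂b′≡ι₂b)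
  ... | inj₁ (a , ι₁a≡ι₂b) with only U a b ι₁a≡ι₂b
  ...   | refl , refl = sym (updateAt-updates x₂ f₂)

  GlueDominated : (Fin n₁ → Fin 3) → (Fin n₂ → Fin 3) → Fin n → Set
  GlueDominated f₁ f₂ v = glue f₁ f₂ v ≡ zero → ∃[ u ] (Adj G v u × glue f₁ f₂ u ≡ two)

  glue-dominated-ι₁ : ∀ {f₁} f₂ → IsRDF G₁ f₁ → ∀ a → GlueDominated f₁ f₂ (ι₁ U a)
  glue-dominated-ι₁ {f₁} f₂ f₁-rdf a ha≡0 with f₁-rdf a (trans (sym (glue-ι₁ f₁ f₂ a)) ha≡0)
  ... | b , adj₁ , f₁b≡2 = ι₁ U b , edges₁ U a b adj₁ , trans (glue-ι₁ f₁ f₂ b) f₁b≡2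

  glue-dominated-ι₂ : ∀ {f₁ f₂} → IsRDF G₁ f₁ → IsRDF G₂ f₂ → f₂ x₂ ≢ two →
    ∀ b → GlueDominated f₁ f₂ (ι₂ U b)
  glue-dominated-ι₂ {f₁} {f₂} f₁-rdf f₂-rdf f₂x≢2 b with b ≟ x₂
  ... | yes refl = subst (GlueDominated f₁ f₂) (common U) (glue-dominated-ι₁ f₂ f₁-rdf x₁)
  ... | no b≢x₂ = λ hb≡0 →
    let (u , adj₂ , f₂u≡2) = f₂-rdf b (trans (sym (updateAt-minimal b x₂ f₂ b≢x₂))
                                            (trans (sym (glue-ι₂ f₁ f₂ b)) hb≡0))
        u≢x₂ : u ≢ x₂
        u≢x₂ u≡x₂ = f₂x≢2 (subst (λ w → f₂ w ≡ two) u≡x₂ f₂u≡2)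
    in ι₂ U u , edges₂ U b u adj₂ , trans (glue-ι₂ f₁ f₂ u) (trans (updateAt-minimal u x₂ f₂ u≢x₂) f₂u≡2)

  glue-RDF : ∀ {f₁ f₂} → IsRDF G₁ f₁ → IsRDF G₂ f₂ → f₂ x₂ ≢ two → IsRDF G (glue f₁ f₂)
  glue-RDF {f₁} {f₂} f₁-rdf f₂-rdf f₂x≢2 v =
    [ (λ (a , ι₁a≡v) → subst (GlueDominated f₁ f₂) ι₁a≡v (glue-dominated-ι₁ f₂ f₁-rdf a))
    , (λ (b , ι₂b≡v) → subst (GlueDominated f₁ f₂) ι₂b≡v (glue-dominated-ι₂ f₁-rdf f₂-rdf f₂x≢2 b))
    ]′ (cover U v)

  glue-weight : ∀ f₁ f₂ → weight (glue f₁ f₂) + toℕ (f₂ x₂) ≡ weight f₁ + weight f₂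
  glue-weight f₁ f₂ = +-cancelʳ-≡ (toℕ c) _ _ (begin
    weight h + d + toℕ c                     ≡⟨ swap-last (weight h) d (toℕ c) ⟩
    weight h + toℕ c + d                     ≡⟨ cong (λ e → weight h + toℕ e + d) (sym (glue-ι₁ f₁ f₂ x₁)) ⟩
    weight h + toℕ (h (ι₁ U x₁)) + d         ≡⟨ cong (_+ d) (weight-union h) ⟩
    weight (h ∘ ι₁ U) + weight (h ∘ ι₂ U) + d
      ≡⟨ cong₂ (λ s t → s + t + d) (weight-cong (glue-ι₁ f₁ f₂)) (weight-cong (glue-ι₂ f₁ f₂)) ⟩
    weight f₁ + weight (f₂ [ x₂ ]≔ c) + d    ≡⟨ +-assoc (weight f₁) _ d ⟩
    weight f₁ + (weight (f₂ [ x₂ ]≔ c) + d)  ≡⟨ cong (weight f₁ +_) (weight-update f₂ x₂ c) ⟩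
    weight f₁ + (weight f₂ + toℕ c)          ≡⟨ sym (+-assoc (weight f₁) (weight f₂) (toℕ c)) ⟩
    weight f₁ + weight f₂ + toℕ c            ∎)
    where
    open ≡-Reasoning
    h = glue f₁ f₂
    c = f₁ x₁
    d = toℕ (f₂ x₂)
    swap-last : ∀ a b c → a + b + c ≡ a + c + b
    swap-last = solve-∀

module _ {n₁ n₂ n : ℕ} {G₁ : Graph n₁} {G₂ : Graph n₂} {G : Graph n}
         {x₁ : Fin n₁} {x₂ : Fin n₂} (U : IsUnionAt G₁ G₂ G x₁ x₂) where

  private
    module U₁ = Union U
    module U₂ = Union (IsUnionAt-swap U)

  glue-γR-functions : ∀ {f₁ f₂ w₁ w₂} → IsγR G₁ w₁ → IsγR G₂ w₂ →
    IsγRFun G₁ f₁ → IsγRFun G₂ f₂ → f₂ x₂ ≡ one →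
    IsRDF G (U₁.glue f₁ f₂) × weight (U₁.glue f₁ f₂) ≡ w₁ + w₂ ∸ 1
  glue-γR-functions {f₁} {f₂} {w₁} {w₂} γ₁ γ₂ f₁-γ f₂-γ f₂x≡1 =
    U₁.glue-RDF (proj₁ f₁-γ) (proj₁ f₂-γ) (λ f₂x≡2 → contradiction (trans (sym f₂x≡1) f₂x≡2) λ ()) ,
    (begin
      weight h                   ≡⟨ sym (m+n∸n≡m (weight h) 1) ⟩
      weight h + 1 ∸ 1           ≡⟨ cong (λ c → weight h + toℕ c ∸ 1) (sym f₂x≡1) ⟩
      weight h + toℕ (f₂ x₂) ∸ 1 ≡⟨ cong (_∸ 1) (U₁.glue-weight f₁ f₂) ⟩
      weight f₁ + weight f₂ ∸ 1
        ≡⟨ cong₂ (λ a b → a + b ∸ 1) (γR-function-weight {H = G₁} {f = f₁} f₁-γ γ₁)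
                                               (γR-function-weight {H = G₂} {f = f₂} f₂-γ γ₂) ⟩
      w₁ + w₂ ∸ 1                ∎)
    where
    open ≡-Reasoning
    h = U₁.glue f₁ f₂

  module _ {g : Fin n → Fin 3} (g-rdf : IsRDF G g) where

    restriction₁ : Fin 3 → Fin n₁ → Fin 3
    restriction₁ c = (g ∘ ι₁ U) [ x₁ ]≔ c

    restriction₂ : Fin 3 → Fin n₂ → Fin 3
    restriction₂ c = (g ∘ ι₂ U) [ x₂ ]≔ c

    restriction₂-RDF : ∀ c → (g (ι₁ U x₁) ≡ two → c ≡ two) →
      (c ≡ zero → ∃[ b ] (Adj G₂ x₂ b × g (ι₂ U b) ≡ two)) → IsRDF G₂ (restriction₂ c)
    restriction₂-RDF c keep-two = U₂.restrict-RDF g-rdf c (keep-two ∘ trans (cong g (common U)))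

    restrictions-weight : ∀ {t} → g (ι₁ U x₁) ≡ t → ∀ c₁ c₂ →
      weight (restriction₁ c₁) + weight (restriction₂ c₂) + toℕ t ≡ weight g + (toℕ c₁ + toℕ c₂)
    restrictions-weight {t} gx≡t c₁ c₂ = +-cancelʳ-≡ (toℕ t) _ _ (begin
      w₁ + w₂ + toℕ t + toℕ t               ≡⟨ regroup₁ w₁ w₂ (toℕ t) ⟩
      (w₁ + toℕ t) + (w₂ + toℕ t)           ≡⟨ cong₂ _+_ at-x₁ at-x₂ ⟩
      (v₁ + toℕ c₁) + (v₂ + toℕ c₂)         ≡⟨ regroup₂ v₁ (toℕ c₁) v₂ (toℕ c₂) ⟩
      (v₁ + v₂) + (toℕ c₁ + toℕ c₂)         ≡⟨ cong (_+ (toℕ c₁ + toℕ c₂)) (sym at-union) ⟩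
      weight g + toℕ t + (toℕ c₁ + toℕ c₂)  ≡⟨ regroup₃ (weight g) (toℕ t) (toℕ c₁ + toℕ c₂) ⟩
      weight g + (toℕ c₁ + toℕ c₂) + toℕ t  ∎)
      where
      open ≡-Reasoning
      w₁ = weight (restriction₁ c₁)
      w₂ = weight (restriction₂ c₂)
      v₁ = weight (g ∘ ι₁ U)
      v₂ = weight (g ∘ ι₂ U)
      at-x₁ : w₁ + toℕ t ≡ v₁ + toℕ c₁
      at-x₁ = subst (λ s → w₁ + toℕ s ≡ v₁ + toℕ c₁) gx≡t (weight-update (g ∘ ι₁ U) x₁ c₁)
      at-x₂ : w₂ + toℕ t ≡ v₂ + toℕ c₂
      at-x₂ = subst (λ s → w₂ + toℕ s ≡ v₂ + toℕ c₂) (trans (cong g (sym (common U))) gx≡t)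
                    (weight-update (g ∘ ι₂ U) x₂ c₂)
      at-union : weight g + toℕ t ≡ v₁ + v₂
      at-union = subst (λ s → weight g + toℕ s ≡ v₁ + v₂) gx≡t (U₁.weight-union g)
      regroup₁ : ∀ a b c → a + b + c + c ≡ (a + c) + (b + c)
      regroup₁ = solve-∀
      regroup₂ : ∀ a b c d → (a + b) + (c + d) ≡ (a + c) + (b + d)
      regroup₂ = solve-∀
      regroup₃ : ∀ a b c → a + b + c ≡ a + c + b
      regroup₃ = solve-∀

    keep-two-vacuous : ∀ {t} → g (ι₁ U x₁) ≡ t → t ≢ two → ∀ {c} → g (ι₁ U x₁) ≡ two → c ≡ two
    keep-two-vacuous gx≡t t≢2 gx≡2 = contradiction (trans (sym gx≡t) gx≡2) t≢2

    restrictions : ∃[ h₁ ] ∃[ h₂ ] (IsRDF G₁ h₁ × IsRDF G₂ h₂ ×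
      (weight h₁ + weight h₂ ≡ weight g + 1 ⊎ (weight h₁ + weight h₂ ≡ weight g + 2 × h₂ x₂ ≡ two)))
    restrictions with g (ι₁ U x₁) in gx≡t
    ... | suc (suc zero) =
      restriction₁ two , restriction₂ two ,
      U₁.restrict-RDF g-rdf two (λ _ → refl) (λ ()) ,
      restriction₂-RDF two (λ _ → refl) (λ ()) ,
      inj₂ (cancel-+ 2 2 (restrictions-weight gx≡t two two) , updateAt-updates x₂ (g ∘ ι₂ U))
    ... | suc zero =
      restriction₁ one , restriction₂ one ,
      U₁.restrict-RDF g-rdf one (keep-two-vacuous gx≡t λ ()) (λ ()) ,
      restriction₂-RDF one (keep-two-vacuous gx≡t λ ()) (λ ()) ,
      inj₁ (cancel-+ 1 1 (restrictions-weight gx≡t one one))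
    ... | zero with g-rdf (ι₁ U x₁) gx≡t
    ...   | u , adj , gu≡2 with U₁.ι₁-neighbour x₁ u adj
    ...     | inj₁ (b , refl , adj₁) =
      restriction₁ zero , restriction₂ one ,
      U₁.restrict-RDF g-rdf zero (keep-two-vacuous gx≡t λ ()) (λ _ → b , adj₁ , gu≡2) ,
      restriction₂-RDF one (keep-two-vacuous gx≡t λ ()) (λ ()) ,
      inj₁ (cancel-+ 1 0 (restrictions-weight gx≡t zero one))
    ...     | inj₂ (_ , b , refl , adj₂) =
      restriction₁ one , restriction₂ zero ,
      U₁.restrict-RDF g-rdf one (keep-two-vacuous gx≡t λ ()) (λ ()) ,
      restriction₂-RDF zero (keep-two-vacuous gx≡t λ ()) (λ _ → b , adj₂ , gu≡2) ,
      inj₁ (cancel-+ 1 0 (restrictions-weight gx≡t one zero))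

  union-lower-bound : ∀ {w₁ w₂} → IsγR G₁ w₁ → IsγR G₂ w₂ → (∀ f → IsγRFun G₂ f → f x₂ ≢ two) →
    ∀ g → IsRDF G g → w₁ + w₂ ∸ 1 ≤ weight g
  union-lower-bound {w₁} {w₂} (_ , w₁-min) γ₂ excluded g g-rdf =
    m≤n+o⇒m∸n≤o (w₁ + w₂) 1 (subst (w₁ + w₂ ≤_) (+-comm (weight g) 1) bound)
    where
    bound : w₁ + w₂ ≤ weight g + 1
    bound with restrictions g-rdf
    ... | h₁ , h₂ , h₁-rdf , h₂-rdf , inj₁ sum≡ =
      subst (w₁ + w₂ ≤_) sum≡ (+-mono-≤ (w₁-min h₁ h₁-rdf) (proj₂ γ₂ h₂ h₂-rdf))
    ... | h₁ , h₂ , h₁-rdf , h₂-rdf , inj₂ (sum≡ , h₂x≡2) =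
      s≤s⁻¹ (subst₂ _≤_ (+-suc w₁ w₂) (trans sum≡ (+-suc (weight g) 1))
        (+-mono-≤ (w₁-min h₁ h₁-rdf)
                  (excluded-value⇒γR<weight {H = G₂} {h = h₂} γ₂ excluded h₂-rdf h₂x≡2)))

lemma3p3 : {n₁ n₂ n : ℕ} (G₁ : Graph n₁) (G₂ : Graph n₂) (G : Graph n)
    (x₁ : Fin n₁) (x₂ : Fin n₂) (U : IsUnionAt G₁ G₂ G x₁ x₂) →
    Connected G₁ → Connected G₂ →
    InV012 G₁ x₁ → InV01 G₂ x₂ →
    (w₁ w₂ : ℕ) → IsγR G₁ w₁ → IsγR G₂ w₂ →
    IsγR G (w₁ + w₂ ∸ 1) × InV012 G (ι₁ U x₁)
lemma3p3 G₁ G₂ G x₁ x₂ U _ _ x∈V012 (_ , (f₂ , f₂-γ , f₂x≡1) , x∉V2) w₁ w₂ γ₁ γ₂ =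
  let (h₀ , h₀-rdf-weight , _) = attains zero
  in ((h₀ , h₀-rdf-weight) , lower) ,
     λ k → let (h , (h-rdf , h-weight) , hx≡k) = attains k
           in h , γR-function-of-weight {H = G} {h = h} h-rdf h-weight lower , hx≡k
  where
  open Union U using (glue; glue-ι₁)
  lower : ∀ g → IsRDF G g → w₁ + w₂ ∸ 1 ≤ weight g
  lower = union-lower-bound U γ₁ γ₂ x∉V2
  attains : ∀ k → ∃[ h ] ((IsRDF G h × weight h ≡ w₁ + w₂ ∸ 1) × h (ι₁ U x₁) ≡ k)
  attains k =
    let (f₁ , f₁-γ , f₁x≡k) = x∈V012 k
    in glue f₁ f₂ , glue-γR-functions U γ₁ γ₂ f₁-γ f₂-γ f₂x≡1 , trans (glue-ι₁ f₁ f₂ x₁) f₁x≡k
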